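{- Let $n,t,m\in\mathbb{N}$ with $tm\le n$ and $2t\le n$. Let $V$ be a set with $n$ elements and let $f:V\to[m]$ be a function with $m=\max_{v\in V}f(v)$. Suppose $x_1,\dots,x_{2tm},y_1,\dots,y_{2tm}$ are elements of $V$ (repetitions allowed) such that $x_i,y_i,x_{tm+i},y_{tm+i}$ are distinct for each $i\in[tm]$. Then there are sets $T_1,\dots,T_{2tm}\subseteq V$ such that (i) for all $v\in V$, $\sum_{i\in[2tm]}I_{T_i}(v)=f(v)+(2t-1)m$; (ii) $|T_i|\ge(1-1/t)n$ for all $i$; (iii) $x_i,y_i\in T_i$ for all $i\in[2tm]$.
   Context: $[m]=\{1,\dots,m\}$. For $U\subseteq V$, $I_U:V\to\{0,1\}$ is the indicator function of $U$. -}

module Defs where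

open import Data.Nat using (ℕ; _+_)
open import Data.Bool using (Bool; true; false)
open import Data.Fin using (Fin)
open import Data.Fin.Subset using (Subset)
open import Data.Vec using (lookup; tabulate; sum)
open import Data.Product using (_×_)
open import Relation.Binary.PropositionalEquality using (_≢_)

I : ∀ {n} → Subset n → Fin n → ℕ
I U v with lookup U v
... | true  = 1
... | false = 0

Σ : ∀ k → (Fin k → ℕ) → ℕ
Σ k g = sum (tabulate g)

Distinct4 : ∀ {n} → Fin n → Fin n → Fin n → Fin n → Set
Distinct4 a b c d =
  (a ≢ b) × (a ≢ c) × (a ≢ d) × (b ≢ c) × (b ≢ d) × (c ≢ d)

-- Index the 2tm sets in pairs (p, tm + p) and the pairs p by (a, b) ∈ [t] × [m]. A vertex v
-- must be missing from 2tm − (f(v) + (2t − 1)m) = m − f(v) < m sets: we let it miss one set of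
-- each of m − f(v) pairs, the second set when v is x_p or y_p and the first one otherwise, so
-- that x_i, y_i ∈ T_i by distinctness. Writing v = a + q t with a < t, the pairs missing v are
-- (a, b) for b among the first m − f(v) numbers other than q. So the vertices missing from the
-- pair (a, b) lie in the residue class of a mod t but exclude a + b t (a vertex since tm ≤ n):
-- there are at most n/t of them, whence |T_i| ≥ (1 − 1/t) n.
module Submission where

open import Defs
open import Data.Nat using (ℕ; zero; suc; _+_; _*_; _∸_; _≤_; _<_; _≡ᵇ_; _<ᵇ_; NonZero; z≤n; s≤s)
open import Data.Nat.Properties
open import Data.Nat.DivMod
open import Data.Nat.Divisibility using (divides-refl; ∣-refl)
open import Data.Nat.Tactic.RingSolver using (solve-∀)
open import Data.Bool using (Bool; true; false; not; _∧_)
open import Data.Bool.Properties using (T-≡; ∧-zeroʳ; ∧-conicalˡ)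
import Data.Fin as Fin
open import Data.Fin using (Fin; _↑ˡ_; _↑ʳ_; toℕ; combine; remQuot; splitAt; join; fromℕ<)
open import Data.Fin.Properties using (toℕ<n; toℕ-↑ˡ; toℕ-↑ʳ; toℕ-fromℕ<; remQuot-combine; join-splitAt)
open import Data.Fin.Subset using (Subset; _∈_; _∉_; _⊆_; ∣_∣; ∁; _∩_; _∪_; ⁅_⁆; _-_)
open import Data.Fin.Subset.Properties
  using (p⊆q⇒∣p∣≤∣q∣; x∈p⇒∣p-x∣<∣p∣; x∈p∧x≢y⇒x∈p-y; ∣∁p∣≡n∸∣p∣; ∣p∣≤n; p∩q⊆p; p⊆q⇒∁p⊇∁q;
         x∉p⇒x∈∁p; x∈p⇒x∉∁p; x∈p∩q⁻; x∈p∪q⁺; x∈p∪q⁻; x∈⁅x⁆; x∈⁅y⁆⇒x≡y)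
open import Data.Product using (Σ-syntax; ∃-syntax; _×_; _,_; proj₁; proj₂; uncurry)
open import Data.Sum using (inj₁; inj₂; [_,_]′)
open import Data.Vec using ([]; _∷_; lookup; tabulate)
open import Data.Vec.Properties using (lookup∘tabulate; lookup-map; lookup-zipWith; lookup⇒[]=; []=⇒lookup)
open import Data.Vec.Functional using (Vector; _++_)
open import Data.Vec.Functional.Properties using (lookup-++ˡ; lookup-++ʳ)
open import Algebra.Properties.Semiring.Sum +-*-semiring
  using (sum; sum-cong-≗; ∑-distrib-+; *-distribˡ-sum; *-distribʳ-sum)
open import Function using (_∘_; case_of_; Equivalence)
open import Relation.Binary.PropositionalEquality
  using (_≡_; _≢_; refl; sym; trans; cong; cong₂; subst; module ≡-Reasoning)

𝟙 : Bool → ℕ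
𝟙 true  = 1
𝟙 false = 0

𝟙≤1 : ∀ b → 𝟙 b ≤ 1
𝟙≤1 true  = ≤-refl
𝟙≤1 false = z≤n

𝟙-∧ : ∀ b c → 𝟙 (b ∧ c) ≡ 𝟙 b * 𝟙 c
𝟙-∧ true  c = sym (+-identityʳ (𝟙 c))
𝟙-∧ false c = refl

𝟙-cover : ∀ d q → 𝟙 (not (d ∧ not q)) + 𝟙 (not (d ∧ q)) + 𝟙 d ≡ 2
𝟙-cover true  true  = refl
𝟙-cover true  false = refl
𝟙-cover false q     = refl

≡ᵇ-comm : ∀ m n → (m ≡ᵇ n) ≡ (n ≡ᵇ m)
≡ᵇ-comm zero    zero    = refl
≡ᵇ-comm zero    (suc n) = refl
≡ᵇ-comm (suc m) zero    = refl
≡ᵇ-comm (suc m) (suc n) = ≡ᵇ-comm m n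

I≡𝟙∘lookup : ∀ {n} (U : Subset n) v → I U v ≡ 𝟙 (lookup U v)
I≡𝟙∘lookup U v with lookup U v
... | true  = refl
... | false = refl

I-tabulate : ∀ {n} (h : Fin n → Bool) v → I (tabulate h) v ≡ 𝟙 (h v)
I-tabulate h v = trans (I≡𝟙∘lookup (tabulate h) v) (cong 𝟙 (lookup∘tabulate h v))

∈-tabulate⁺ : ∀ {n} {h : Fin n → Bool} {v} → h v ≡ true → v ∈ tabulate h
∈-tabulate⁺ {h = h} {v} hv = lookup⇒[]= v (tabulate h) (trans (lookup∘tabulate h v) hv)

∈-tabulate⁻ : ∀ {n} {h : Fin n → Bool} {v} → v ∈ tabulate h → h v ≡ true
∈-tabulate⁻ {h = h} {v} v∈ = trans (sym (lookup∘tabulate h v)) ([]=⇒lookup v∈)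

↑-elim : ∀ {m n} (P : Fin (m + n) → Set) → (∀ i → P (i ↑ˡ n)) → (∀ j → P (m ↑ʳ j)) → ∀ k → P k
↑-elim {m} {n} P left right k = subst P (join-splitAt m n k) (by-side (splitAt m k))
  where
    by-side : ∀ s → P (join m n s)
    by-side (inj₁ i) = left i
    by-side (inj₂ j) = right j

I-∁∩ : ∀ {n} (p q : Subset n) v → I (∁ (p ∩ q)) v ≡ 𝟙 (not (lookup p v ∧ lookup q v))
I-∁∩ p q v = trans (I≡𝟙∘lookup (∁ (p ∩ q)) v)
                   (cong 𝟙 (trans (lookup-map v not (p ∩ q)) (cong not (lookup-zipWith _∧_ v p q))))

∉⇒∈∁∩ : ∀ {n} (p : Subset n) {q v} → v ∉ q → v ∈ ∁ (p ∩ q)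
∉⇒∈∁∩ p {q} v∉q = x∉p⇒x∈∁p (v∉q ∘ proj₂ ∘ x∈p∩q⁻ p q)

n≤∣∁[p∩q]∣+∣p∣ : ∀ {n} (p q : Subset n) → n ≤ ∣ ∁ (p ∩ q) ∣ + ∣ p ∣
n≤∣∁[p∩q]∣+∣p∣ {n} p q = begin
  n                     ≡⟨ m∸n+n≡m (∣p∣≤n p) ⟨
  n ∸ ∣ p ∣ + ∣ p ∣     ≡⟨ cong (_+ ∣ p ∣) (∣∁p∣≡n∸∣p∣ p) ⟨
  ∣ ∁ p ∣ + ∣ p ∣       ≤⟨ +-monoˡ-≤ ∣ p ∣ (p⊆q⇒∣p∣≤∣q∣ (p⊆q⇒∁p⊇∁q (p∩q⊆p p q))) ⟩
  ∣ ∁ (p ∩ q) ∣ + ∣ p ∣ ∎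
  where open ≤-Reasoning

Σ≡sum : ∀ k (g : Fin k → ℕ) → Σ k g ≡ sum g
Σ≡sum zero    g = refl
Σ≡sum (suc k) g = cong (g Fin.zero +_) (Σ≡sum k (g ∘ Fin.suc))

sum-const : ∀ k c → sum {k} (λ _ → c) ≡ k * c
sum-const zero    c = refl
sum-const (suc k) c = cong (c +_) (sum-const k c)

sum-↑ : ∀ a b (g : Vector ℕ (a + b)) → sum g ≡ sum (g ∘ (_↑ˡ b)) + sum (g ∘ (a ↑ʳ_))
sum-↑ zero    b g = refl
sum-↑ (suc a) b g = trans (cong (g Fin.zero +_) (sum-↑ a b (g ∘ Fin.suc))) (sym (+-assoc (g Fin.zero) _ _))

sum-combine : ∀ a b (g : Vector ℕ (a * b)) → sum g ≡ sum {a} (λ i → sum {b} (λ j → g (combine i j)))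
sum-combine zero    b g = refl
sum-combine (suc a) b g = trans (sum-↑ b (a * b) g) (cong (sum {b} (λ j → g (j ↑ˡ a * b)) +_) (sum-combine a b (g ∘ (b ↑ʳ_))))

-- sum-cong-≗ with the length made explicit: sum unfolds to a foldr that does not determine it.
sum-cong : ∀ k {g h : Vector ℕ k} → (∀ i → g i ≡ h i) → sum g ≡ sum h
sum-cong k = sum-cong-≗

∣p∣≡sum𝟙 : ∀ {n} (p : Subset n) → ∣ p ∣ ≡ sum (𝟙 ∘ lookup p)
∣p∣≡sum𝟙 []          = refl
∣p∣≡sum𝟙 (true ∷ p)  = cong suc (∣p∣≡sum𝟙 p)
∣p∣≡sum𝟙 (false ∷ p) = ∣p∣≡sum𝟙 p

∣tabulate∣≡sum𝟙 : ∀ {n} (h : Fin n → Bool) → ∣ tabulate h ∣ ≡ sum (𝟙 ∘ h)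
∣tabulate∣≡sum𝟙 h = trans (∣p∣≡sum𝟙 (tabulate h)) (sum-cong _ (cong 𝟙 ∘ lookup∘tabulate h))

sum-≡ᵇ : ∀ r a → sum {r} (λ j → 𝟙 (toℕ j ≡ᵇ a)) ≡ 𝟙 (a <ᵇ r)
sum-≡ᵇ zero    a       = refl
sum-≡ᵇ (suc r) zero    = cong suc (trans (sum-const r 0) (*-zeroʳ r))
sum-≡ᵇ (suc r) (suc a) = sum-≡ᵇ r a

sum-<ᵇ : ∀ {m k} → k ≤ m → sum {m} (λ j → 𝟙 (toℕ j <ᵇ k)) ≡ k
sum-<ᵇ {m} {zero}  _         = trans (sum-const m 0) (*-zeroʳ m)
sum-<ᵇ {suc m} {suc k} (s≤s k≤m) = cong suc (sum-<ᵇ k≤m)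

module _ (t : ℕ) .{{_ : NonZero t}} (a : ℕ) where

  residueCount : ℕ → ℕ
  residueCount n = sum {n} (λ j → 𝟙 (toℕ j % t ≡ᵇ a))

  residueCount-≤1 : ∀ {r} → r ≤ t → residueCount r ≤ 1
  residueCount-≤1 {r} r≤t = begin
    residueCount r                   ≡⟨ sum-cong r (λ j → cong (λ z → 𝟙 (z ≡ᵇ a)) (m<n⇒m%n≡m (<-≤-trans (toℕ<n j) r≤t))) ⟩
    sum {r} (λ j → 𝟙 (toℕ j ≡ᵇ a))  ≡⟨ sum-≡ᵇ r a ⟩
    𝟙 (a <ᵇ r)                       ≤⟨ 𝟙≤1 (a <ᵇ r) ⟩
    1                                ∎
    where open ≤-Reasoning

  residueCount-t+ : ∀ n → residueCount (t + n) ≤ 1 + residueCount n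
  residueCount-t+ n = begin
    residueCount (t + n)                                   ≡⟨ sum-↑ t n (λ j → 𝟙 (toℕ j % t ≡ᵇ a)) ⟩
    sum {t} (λ j → 𝟙 (toℕ (j ↑ˡ n) % t ≡ᵇ a)) + sum {n} (λ j → 𝟙 (toℕ (t ↑ʳ j) % t ≡ᵇ a))
      ≡⟨ cong₂ _+_ (sum-cong t (λ j → cong (λ z → 𝟙 (z % t ≡ᵇ a)) (toℕ-↑ˡ j n)))
                   (sum-cong n (λ j → cong (λ z → 𝟙 (z ≡ᵇ a)) (trans (cong (_% t) (toℕ-↑ʳ t j)) (%-remove-+ˡ (toℕ j) ∣-refl)))) ⟩
    residueCount t + residueCount n                        ≤⟨ +-monoˡ-≤ (residueCount n) (residueCount-≤1 ≤-refl) ⟩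
    1 + residueCount n                                     ∎
    where open ≤-Reasoning

  residueCount-blocks : ∀ q {r} → r ≤ t → residueCount (q * t + r) ≤ suc q
  residueCount-blocks zero    r≤t = residueCount-≤1 r≤t
  residueCount-blocks (suc q) {r} r≤t = begin
    residueCount ((t + q * t) + r) ≡⟨ cong residueCount (+-assoc t (q * t) r) ⟩
    residueCount (t + (q * t + r)) ≤⟨ residueCount-t+ (q * t + r) ⟩
    1 + residueCount (q * t + r)   ≤⟨ s≤s (residueCount-blocks q r≤t) ⟩
    suc (suc q)                    ∎
    where open ≤-Reasoning

  t*residueCount≤t+n : ∀ n → t * residueCount n ≤ t + n
  t*residueCount≤t+n n = begin
    t * residueCount n                       ≡⟨ cong (λ z → t * residueCount z) n≡qt+r ⟩
    t * residueCount (n / t * t + n % t)     ≤⟨ *-monoʳ-≤ t (residueCount-blocks (n / t) (m%n≤n n t)) ⟩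
    t * suc (n / t)                          ≡⟨ trans (*-suc t (n / t)) (cong (t +_) (*-comm t (n / t))) ⟩
    t + n / t * t                            ≤⟨ +-monoʳ-≤ t (m/n*n≤m n t) ⟩
    t + n                                    ∎
    where
      open ≤-Reasoning
      n≡qt+r : n ≡ n / t * t + n % t
      n≡qt+r = trans (m≡m%n+[m/n]*n n t) (+-comm (n % t) _)

-- firstExcept k q b: b is one of the k least natural numbers different from q.
firstExcept : ℕ → ℕ → ℕ → Bool
firstExcept zero    q       b       = false
firstExcept (suc k) zero    zero    = false
firstExcept (suc k) zero    (suc b) = b <ᵇ suc k
firstExcept (suc k) (suc q) zero    = true
firstExcept (suc k) (suc q) (suc b) = firstExcept k q b

firstExcept-self : ∀ k q → firstExcept k q q ≡ false
firstExcept-self zero    q       = refl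
firstExcept-self (suc k) zero    = refl
firstExcept-self (suc k) (suc q) = firstExcept-self k q

sum-firstExcept : ∀ {m k} q → k < m → sum {m} (λ b → 𝟙 (firstExcept k q (toℕ b))) ≡ k
sum-firstExcept {m}     {zero}  q       _         = trans (sum-const m 0) (*-zeroʳ m)
sum-firstExcept {suc m} {suc k} zero    (s≤s k<m) = sum-<ᵇ k<m
sum-firstExcept {suc m} {suc k} (suc q) (s≤s k<m) = cong suc (sum-firstExcept q k<m)

module Absences (t m n : ℕ) .{{_ : NonZero t}} (k : Fin n → ℕ) where

  inClass : Fin t → Fin n → Bool
  inClass a v = toℕ v % t ≡ᵇ toℕ a

  absent : Fin t → Fin m → Subset n
  absent a b = tabulate λ v → inClass a v ∧ firstExcept (k v) (toℕ v / t) (toℕ b)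

  absentAt : Fin (t * m) → Subset n
  absentAt p = uncurry absent (remQuot m p)

  sum-inClass : ∀ v → sum {t} (λ a → 𝟙 (inClass a v)) ≡ 1
  sum-inClass v = begin
    sum {t} (λ a → 𝟙 (toℕ v % t ≡ᵇ toℕ a)) ≡⟨ sum-cong t (λ a → cong 𝟙 (≡ᵇ-comm (toℕ v % t) (toℕ a))) ⟩
    sum {t} (λ a → 𝟙 (toℕ a ≡ᵇ toℕ v % t)) ≡⟨ sum-≡ᵇ t (toℕ v % t) ⟩
    𝟙 (toℕ v % t <ᵇ t)                     ≡⟨ cong 𝟙 (Equivalence.to T-≡ (<⇒<ᵇ (m%n<n (toℕ v) t))) ⟩
    1                                       ∎
    where open ≡-Reasoning

  sum-absent : ∀ v → k v < m → sum {t * m} (λ p → I (absentAt p) v) ≡ k v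
  sum-absent v k<m = begin
    sum {t * m} (λ p → I (absentAt p) v)
      ≡⟨ sum-combine t m _ ⟩
    sum {t} (λ a → sum {m} (λ b → I (absentAt (combine a b)) v))
      ≡⟨ sum-cong t (λ a → sum-cong m (λ b → trans (cong (λ ab → I (uncurry absent ab) v) (remQuot-combine a b))
                                                    (trans (I-tabulate _ v) (𝟙-∧ (inClass a v) (window b))))) ⟩
    sum {t} (λ a → sum {m} (λ b → 𝟙 (inClass a v) * 𝟙 (window b)))
      ≡⟨ sum-cong t (λ a → sym (*-distribˡ-sum (𝟙 (inClass a v)) (λ b → 𝟙 (window b)))) ⟩
    sum {t} (λ a → 𝟙 (inClass a v) * sum {m} (λ b → 𝟙 (window b)))
      ≡⟨ sum-cong t (λ a → cong (𝟙 (inClass a v) *_) (sum-firstExcept (toℕ v / t) k<m)) ⟩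
    sum {t} (λ a → 𝟙 (inClass a v) * k v)
      ≡⟨ sym (*-distribʳ-sum (k v) (λ a → 𝟙 (inClass a v))) ⟩
    sum {t} (λ a → 𝟙 (inClass a v)) * k v
      ≡⟨ cong (_* k v) (sum-inClass v) ⟩
    1 * k v
      ≡⟨ *-identityˡ (k v) ⟩
    k v ∎
    where
      open ≡-Reasoning
      window : Fin m → Bool
      window b = firstExcept (k v) (toℕ v / t) (toℕ b)

  module _ (tm≤n : t * m ≤ n) (a : Fin t) (b : Fin m) where

    skipped<tm : toℕ a + toℕ b * t < t * m
    skipped<tm = begin-strict
      toℕ a + toℕ b * t <⟨ +-monoˡ-< (toℕ b * t) (toℕ<n a) ⟩
      suc (toℕ b) * t   ≤⟨ *-monoˡ-≤ t (toℕ<n b) ⟩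
      m * t             ≡⟨ *-comm m t ⟩
      t * m             ∎
      where open ≤-Reasoning

    skipped : Fin n
    skipped = fromℕ< (<-≤-trans skipped<tm tm≤n)

    skipped%t : toℕ skipped % t ≡ toℕ a
    skipped%t = begin
      toℕ skipped % t             ≡⟨ cong (_% t) (toℕ-fromℕ< _) ⟩
      (toℕ a + toℕ b * t) % t     ≡⟨ [m+kn]%n≡m%n (toℕ a) (toℕ b) t ⟩
      toℕ a % t                   ≡⟨ m<n⇒m%n≡m (toℕ<n a) ⟩
      toℕ a                       ∎
      where open ≡-Reasoning

    skipped/t : toℕ skipped / t ≡ toℕ b
    skipped/t = begin
      toℕ skipped / t             ≡⟨ cong (_/ t) (toℕ-fromℕ< _) ⟩
      (toℕ a + toℕ b * t) / t     ≡⟨ +-distrib-/-∣ʳ (toℕ a) (divides-refl (toℕ b)) ⟩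
      toℕ a / t + toℕ b * t / t   ≡⟨ cong₂ _+_ (m<n⇒m/n≡0 (toℕ<n a)) (m*n/n≡m (toℕ b) t) ⟩
      toℕ b                       ∎
      where open ≡-Reasoning

    skipped∈class : skipped ∈ tabulate (inClass a)
    skipped∈class = ∈-tabulate⁺ (Equivalence.to T-≡ (≡⇒≡ᵇ _ _ skipped%t))

    skipped∉absent : skipped ∉ absent a b
    skipped∉absent skipped∈ = case trans (sym (∈-tabulate⁻ skipped∈)) absent-at-skipped of λ ()
      where
        absent-at-skipped : inClass a skipped ∧ firstExcept (k skipped) (toℕ skipped / t) (toℕ b) ≡ false
        absent-at-skipped = begin
          inClass a skipped ∧ firstExcept (k skipped) (toℕ skipped / t) (toℕ b)
            ≡⟨ cong (λ q → inClass a skipped ∧ firstExcept (k skipped) q (toℕ b)) skipped/t ⟩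
          inClass a skipped ∧ firstExcept (k skipped) (toℕ b) (toℕ b)
            ≡⟨ cong (inClass a skipped ∧_) (firstExcept-self (k skipped) (toℕ b)) ⟩
          inClass a skipped ∧ false
            ≡⟨ ∧-zeroʳ (inClass a skipped) ⟩
          false ∎
          where open ≡-Reasoning

    absent⊆class-skipped : absent a b ⊆ tabulate (inClass a) - skipped
    absent⊆class-skipped v∈ =
      x∈p∧x≢y⇒x∈p-y (∈-tabulate⁺ (∧-conicalˡ _ _ (∈-tabulate⁻ v∈))) (λ { refl → skipped∉absent v∈ })

    t*∣absent∣≤n : t * ∣ absent a b ∣ ≤ n
    t*∣absent∣≤n = +-cancelˡ-≤ t _ _ (begin
      t + t * ∣ absent a b ∣      ≡⟨ *-suc t _ ⟨
      t * suc ∣ absent a b ∣      ≤⟨ *-monoʳ-≤ t (≤-<-trans (p⊆q⇒∣p∣≤∣q∣ absent⊆class-skipped) (x∈p⇒∣p-x∣<∣p∣ skipped∈class)) ⟩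
      t * ∣ tabulate (inClass a) ∣ ≡⟨ cong (t *_) (∣tabulate∣≡sum𝟙 (inClass a)) ⟩
      t * residueCount t (toℕ a) n ≤⟨ t*residueCount≤t+n t (toℕ a) n ⟩
      t + n                        ∎)
      where open ≤-Reasoning

module Pairing {N n : ℕ} (D : Fin N → Subset n) (x y : Fin (N + N) → Fin n) where

  near : Fin N → Subset n
  near p = ⁅ x (p ↑ˡ N) ⁆ ∪ ⁅ y (p ↑ˡ N) ⁆

  T₁ T₂ : Fin N → Subset n
  T₁ p = ∁ (D p ∩ ∁ (near p))
  T₂ p = ∁ (D p ∩ near p)

  T : Fin (N + N) → Subset n
  T = T₁ ++ T₂

  T-cases : (P : Fin (N + N) → Subset n → Set) →
            (∀ p → P (p ↑ˡ N) (T₁ p)) → (∀ p → P (N ↑ʳ p) (T₂ p)) → ∀ i → P i (T i)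
  T-cases P left right = ↑-elim (λ i → P i (T i))
    (λ p → subst (P (p ↑ˡ N)) (sym (lookup-++ˡ T₁ T₂ p)) (left p))
    (λ p → subst (P (N ↑ʳ p)) (sym (lookup-++ʳ T₁ T₂ p)) (right p))

  cover-at : ∀ p v → I (T₁ p) v + I (T₂ p) v + I (D p) v ≡ 2
  cover-at p v = begin
    I (T₁ p) v + I (T₂ p) v + I (D p) v
      ≡⟨ cong₂ _+_ (cong₂ _+_ (I-∁∩ (D p) (∁ (near p)) v) (I-∁∩ (D p) (near p) v)) (I≡𝟙∘lookup (D p) v) ⟩
    𝟙 (not (d ∧ lookup (∁ (near p)) v)) + 𝟙 (not (d ∧ q)) + 𝟙 d
      ≡⟨ cong (λ z → 𝟙 (not (d ∧ z)) + 𝟙 (not (d ∧ q)) + 𝟙 d) (lookup-map v not (near p)) ⟩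
    𝟙 (not (d ∧ not q)) + 𝟙 (not (d ∧ q)) + 𝟙 d
      ≡⟨ 𝟙-cover d q ⟩
    2 ∎
    where
      open ≡-Reasoning
      d = lookup (D p) v
      q = lookup (near p) v

  T-cover : ∀ v → sum {N + N} (λ i → I (T i) v) + sum {N} (λ p → I (D p) v) ≡ N * 2
  T-cover v = begin
    sum {N + N} (λ i → I (T i) v) + sum {N} (λ p → I (D p) v)
      ≡⟨ cong (_+ sum {N} (λ p → I (D p) v)) (sum-↑ N N (λ i → I (T i) v)) ⟩
    sum {N} (λ p → I (T (p ↑ˡ N)) v) + sum {N} (λ p → I (T (N ↑ʳ p)) v) + sum {N} (λ p → I (D p) v)
      ≡⟨ cong₂ (λ S₁ S₂ → S₁ + S₂ + sum {N} (λ p → I (D p) v))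
               (sum-cong N (λ p → cong (λ S → I S v) (lookup-++ˡ T₁ T₂ p)))
               (sum-cong N (λ p → cong (λ S → I S v) (lookup-++ʳ T₁ T₂ p))) ⟩
    sum {N} (λ p → I (T₁ p) v) + sum {N} (λ p → I (T₂ p) v) + sum {N} (λ p → I (D p) v)
      ≡⟨ cong (_+ sum {N} (λ p → I (D p) v)) (∑-distrib-+ (λ p → I (T₁ p) v) (λ p → I (T₂ p) v)) ⟨
    sum {N} (λ p → I (T₁ p) v + I (T₂ p) v) + sum {N} (λ p → I (D p) v)
      ≡⟨ ∑-distrib-+ (λ p → I (T₁ p) v + I (T₂ p) v) (λ p → I (D p) v) ⟨
    sum {N} (λ p → I (T₁ p) v + I (T₂ p) v + I (D p) v)
      ≡⟨ sum-cong N (λ p → cover-at p v) ⟩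
    sum {N} (λ _ → 2)
      ≡⟨ sum-const N 2 ⟩
    N * 2 ∎
    where open ≡-Reasoning

  T-size : ∀ i → ∃[ p ] n ≤ ∣ T i ∣ + ∣ D p ∣
  T-size = T-cases (λ _ S → ∃[ p ] n ≤ ∣ S ∣ + ∣ D p ∣)
    (λ p → p , n≤∣∁[p∩q]∣+∣p∣ (D p) (∁ (near p)))
    (λ p → p , n≤∣∁[p∩q]∣+∣p∣ (D p) (near p))

  ∉near : ∀ {p z} → z ≢ x (p ↑ˡ N) → z ≢ y (p ↑ˡ N) → z ∉ near p
  ∉near z≢x z≢y z∈ = [ z≢x ∘ x∈⁅y⁆⇒x≡y _ , z≢y ∘ x∈⁅y⁆⇒x≡y _ ]′ (x∈p∪q⁻ _ _ z∈)

  T-∋ : (∀ p → Distinct4 (x (p ↑ˡ N)) (y (p ↑ˡ N)) (x (N ↑ʳ p)) (y (N ↑ʳ p))) →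
        ∀ i → x i ∈ T i × y i ∈ T i
  T-∋ distinct = T-cases (λ i S → x i ∈ S × y i ∈ S)
    (λ p → ∉⇒∈∁∩ (D p) (x∈p⇒x∉∁p (x∈p∪q⁺ (inj₁ (x∈⁅x⁆ _))))
         , ∉⇒∈∁∩ (D p) (x∈p⇒x∉∁p (x∈p∪q⁺ (inj₂ (x∈⁅x⁆ _)))))
    (λ p → let (_ , a≢c , a≢d , b≢c , b≢d , _) = distinct p in
           ∉⇒∈∁∩ (D p) (∉near (a≢c ∘ sym) (b≢c ∘ sym))
         , ∉⇒∈∁∩ (D p) (∉near (a≢d ∘ sym) (b≢d ∘ sym)))

a+[2t∸1]m+[m∸a]≡tm*2 : ∀ t m a → a ≤ m → a + (2 * suc t ∸ 1) * m + (m ∸ a) ≡ suc t * m * 2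
a+[2t∸1]m+[m∸a]≡tm*2 t m a a≤m = begin
  a + X + (m ∸ a)    ≡⟨ regroup a X (m ∸ a) ⟩
  X + (a + (m ∸ a))  ≡⟨ cong (X +_) (m+[n∸m]≡n a≤m) ⟩
  X + m              ≡⟨ count t m ⟩
  suc t * m * 2      ∎
  where
    open ≡-Reasoning
    X = (2 * suc t ∸ 1) * m
    regroup : ∀ a x b → a + x + b ≡ x + (a + b)
    regroup = solve-∀
    count : ∀ t m → (t + suc (t + 0)) * m + m ≡ (m + t * m) * 2
    count = solve-∀

t*n≤t*s+n : ∀ t {n s d} → n ≤ s + d → t * d ≤ n → t * n ≤ t * s + n
t*n≤t*s+n t {n} {s} {d} n≤s+d td≤n = begin
  t * n           ≤⟨ *-monoʳ-≤ t n≤s+d ⟩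
  t * (s + d)     ≡⟨ *-distribˡ-+ t s d ⟩
  t * s + t * d   ≤⟨ +-monoʳ-≤ (t * s) td≤n ⟩
  t * s + n       ∎
  where open ≤-Reasoning

proposition6p3 :
    (n t m : ℕ) → 1 ≤ t → t * m ≤ n → 2 * t ≤ n →
    (f : Fin n → ℕ) →
    (∀ v → 1 ≤ f v × f v ≤ m) →
    (∃[ v ] f v ≡ m) →
    (x y : Fin (t * m + t * m) → Fin n) →
    (∀ (i : Fin (t * m)) →
      Distinct4 (x (i ↑ˡ t * m)) (y (i ↑ˡ t * m))
                (x (t * m ↑ʳ i)) (y (t * m ↑ʳ i))) →
    Σ[ T ∈ (Fin (t * m + t * m) → Subset n) ]
      ((∀ v → Σ (t * m + t * m) (λ i → I (T i) v) ≡ f v + (2 * t ∸ 1) * m)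
      × (∀ i → t * n ≤ t * ∣ T i ∣ + n)
      × (∀ i → x i ∈ T i × y i ∈ T i))
proposition6p3 n zero m () _ _ _ _ _ _ _ _
proposition6p3 n t@(suc t′) m _ tm≤n _ f f-range _ x y distinct = T , cover , size , T-∋ distinct
  where
    open Absences t m n (λ v → m ∸ f v)
    open Pairing absentAt x y

    cover : ∀ v → Σ (t * m + t * m) (λ i → I (T i) v) ≡ f v + (2 * t ∸ 1) * m
    cover v = +-cancelʳ-≡ (m ∸ f v) _ _ (begin
      Σ (t * m + t * m) (λ i → I (T i) v) + (m ∸ f v)
        ≡⟨ cong₂ _+_ (Σ≡sum (t * m + t * m) (λ i → I (T i) v)) (sym (sum-absent v (∸-monoʳ-< (proj₁ (f-range v)) (proj₂ (f-range v))))) ⟩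
      sum {t * m + t * m} (λ i → I (T i) v) + sum {t * m} (λ p → I (absentAt p) v)
        ≡⟨ T-cover v ⟩
      t * m * 2
        ≡⟨ a+[2t∸1]m+[m∸a]≡tm*2 t′ m (f v) (proj₂ (f-range v)) ⟨
      f v + (2 * t ∸ 1) * m + (m ∸ f v) ∎)
      where open ≡-Reasoning

    size : ∀ i → t * n ≤ t * ∣ T i ∣ + n
    size i = let (p , n≤) = T-size i
                 (a , b)  = remQuot m p
             in t*n≤t*s+n t n≤ (t*∣absent∣≤n tm≤n a b)
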